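{- Let $\sigma, \tau \in S_n$, and define \[ \delta(\sigma,\tau) = \big|\big\{ x \in \{n-1, \, \sigma^{ -1}(n-1), \, \tau^{ -1}(n-1)\} : \sigma(x) \neq \tau(x) \big\}\big| \] and \[ \delta^{\mathsf{CT}}(\sigma,\tau) = \big|\big\{ x \in \{\sigma^{ -1}(n-1), \, \tau^{ -1}(n-1)\} : \sigma^{\mathsf{CT}}(x) \neq \tau^{\mathsf{CT}}(x) \big\}\big|. \] Then ${\rm hd}(\sigma,\tau) - {\rm hd}\big(\sigma^{\mathsf{CT}},\tau^{\mathsf{CT}}\big) = \delta(\sigma,\tau) - \delta^{\mathsf{CT}}(\sigma,\tau)$.
   Context: $S_n$ is the symmetric group on $\{0,1,\ldots,n-1\}$. The Hamming distance of permutations $\sigma,\tau$ on the same symbol set is ${\rm hd}(\sigma,\tau)=|\{x: \sigma(x)\neq\tau(x)\}|$. The contraction of $\sigma\in S_n$ is the permutation $\sigma^{\mathsf{CT}}\in S_{n-1}$ (on $\{0,\ldots,n-2\}$) defined by $\sigma^{\mathsf{CT}}(x)=\sigma(n-1)$ if $x=\sigma^{ -1}(n-1)$ and $\sigma^{\mathsf{CT}}(x)=\sigma(x)$ otherwise (i.e. delete $n-1$ from the cycle notation of $\sigma$). In the definition of $\delta^{\mathsf{CT}}$, elements $x$ of the set equal to $n-1$ (if any) are understood as not contributing, since $\sigma^{\mathsf{CT}}$ is defined only on $\{0,\ldots,n-2\}$. -}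

module Defs where

open import Data.Nat using (ℕ; suc)
open import Data.Integer using (ℤ; +_; _-_)
open import Data.Fin using (Fin; fromℕ; inject₁; lower₁; toℕ; _≟_)
open import Data.Fin.Properties using (toℕ-injective; toℕ-fromℕ; fromℕ≢inject₁)
open import Data.Fin.Permutation using (Permutation′; _⟨$⟩ʳ_; _⟨$⟩ˡ_; inverseˡ)
open import Data.List using (List; length; filter)
open import Data.List.Base using () renaming (allFin to allFinL)
open import Data.Sum using (_⊎_)
open import Data.Product using (_×_)
open import Relation.Nullary using (¬_; Dec; yes; no)
open import Relation.Nullary.Decidable using (_×-dec_; _⊎-dec_; ¬?)
open import Relation.Unary using (Pred; Decidable)
open import Level using (0ℓ)
open import Relation.Binary.PropositionalEquality using (_≡_; _≢_; refl; sym; trans; cong)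

S : ℕ → Set
S n = Permutation′ n

count : ∀ {n} {P : Pred (Fin n) 0ℓ} → Decidable P → ℕ
count {n} P? = length (filter P? (allFinL n))

hd : ∀ {n} → (Fin n → Fin n) → (Fin n → Fin n) → ℕ
hd σ τ = count (λ x → ¬? (σ x ≟ τ x))

-- the largest symbol n-1 of Fin (suc m)  (here n = suc m)
top : ∀ m → Fin (suc m)
top m = fromℕ m

-- Contraction σ^CT ∈ S_m of σ ∈ S_(suc m):
--   σ^CT x = σ (m)   if σ x = m   (i.e. x = σ⁻¹ m)
--   σ^CT x = σ x     otherwise
-- (deleting m from the cycle notation of σ). The value always lies in
-- {0,…,m-1}; it is lowered into Fin m with a proof of this.
private
  fromℕ-toℕ : ∀ m {y : Fin (suc m)} → m ≡ toℕ y → y ≡ fromℕ m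
  fromℕ-toℕ m {y} e = toℕ-injective (trans (sym e) (sym (toℕ-fromℕ m)))

CT : ∀ {m} → S (suc m) → Fin m → Fin m
CT {m} σ x with σ ⟨$⟩ʳ inject₁ x ≟ top m
... | no ne = lower₁ (σ ⟨$⟩ʳ inject₁ x) (λ e → ne (fromℕ-toℕ m e))
... | yes eq = lower₁ (σ ⟨$⟩ʳ top m) bad
  where
  bad : m ≢ toℕ (σ ⟨$⟩ʳ top m)
  bad e = fromℕ≢inject₁ (begin-eq)
    where
    begin-eq : fromℕ m ≡ inject₁ x
    begin-eq = trans (sym (inverseˡ σ))
               (trans (cong (σ ⟨$⟩ˡ_) (trans (fromℕ-toℕ m e) (sym eq)))
                      (inverseˡ σ))

δ : ∀ {m} → S (suc m) → S (suc m) → ℕ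
δ {m} σ τ = count (λ x →
  ((x ≟ top m) ⊎-dec ((x ≟ σ ⟨$⟩ˡ top m) ⊎-dec (x ≟ τ ⟨$⟩ˡ top m)))
  ×-dec ¬? (σ ⟨$⟩ʳ x ≟ τ ⟨$⟩ʳ x))

-- δ^CT(σ,τ) = |{x ∈ {σ⁻¹(n-1), τ⁻¹(n-1)} : σ^CT x ≠ τ^CT x}|,
-- where elements equal to n-1 do not contribute (x ranges over Fin m,
-- embedded in Fin (suc m) by inject₁).
δCT : ∀ {m} → S (suc m) → S (suc m) → ℕ
δCT {m} σ τ = count (λ (x : Fin m) →
  ((inject₁ x ≟ σ ⟨$⟩ˡ top m) ⊎-dec (inject₁ x ≟ τ ⟨$⟩ˡ top m))
  ×-dec ¬? (CT σ x ≟ CT τ x))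

-- All four quantities are sums of 0/1 indicators over the points, so it suffices to
-- show hd σ τ + δCT ≡ hd σ^CT τ^CT + δ summand by summand. Away from n-1 and the
-- preimages σ⁻¹(n-1), τ⁻¹(n-1) both δ-summands vanish and the contractions agree with
-- σ and τ; at the preimages and at n-1 each δ-summand equals the Hamming summand of
-- the same point.
module Submission where

open import Defs
open import Data.Nat using (ℕ; suc; _+_)
import Data.Nat.Properties as ℕ
open import Data.Integer using (+_; _-_; _⊖_)
open import Data.Integer.Properties using ([+m]-[+n]≡m⊖n; +-cancelˡ-⊖)
open import Data.Fin as Fin using (Fin; inject₁; _≟_)
open import Data.Fin.Properties using (inject₁-lower₁; inject₁-injective; fromℕ≢inject₁)
open import Data.Fin.Permutation using (_⟨$⟩ʳ_; _⟨$⟩ˡ_; inverseˡ)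
open import Data.List using (length; filter; tabulate)
open import Data.Sum using (inj₁; inj₂; [_,_]; _⊎_)
open import Data.Product using (_×_; _,_; proj₂)
open import Data.Empty using (⊥-elim)
open import Function using (_∘_)
open import Level using (0ℓ)
open import Relation.Nullary using (¬_; Dec; yes; no)
open import Relation.Nullary.Decidable using (_×-dec_; _⊎-dec_; ¬?)
open import Relation.Unary using (Pred; Decidable)
open import Relation.Binary.PropositionalEquality
  using (_≡_; _≢_; refl; sym; trans; cong; cong₂; module ≡-Reasoning)
open import Algebra.Properties.CommutativeMonoid.Sum ℕ.+-0-commutativeMonoid
  using (sum; sum-syntax; ∑-distrib-+; sum-cong-≗; sum-init-last)
open import Algebra.Properties.CommutativeSemigroup ℕ.+-commutativeSemigroup
  using (xy∙z≈xz∙y)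

open ≡-Reasoning

indicator : ∀ {p} {P : Set p} → Dec P → ℕ
indicator (yes _) = 1
indicator (no _)  = 0

indicator-cong : ∀ {p q} {P : Set p} {Q : Set q} (d : Dec P) (e : Dec Q) →
  (P → Q) → (Q → P) → indicator d ≡ indicator e
indicator-cong (yes _) (yes _) _   _   = refl
indicator-cong (yes p) (no ¬q) p→q _   = ⊥-elim (¬q (p→q p))
indicator-cong (no ¬p) (yes q) _   q→p = ⊥-elim (¬p (q→p q))
indicator-cong (no _)  (no _)  _   _   = refl

indicator-×-yes : ∀ {p q} {P : Set p} {Q : Set q} (d : Dec P) (e : Dec Q) →
  P → indicator (d ×-dec e) ≡ indicator e
indicator-×-yes d e p = indicator-cong (d ×-dec e) e proj₂ (p ,_)

indicator-×-no : ∀ {p q} {P : Set p} {Q : Set q} (d : Dec P) (e : Dec Q) →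
  ¬ P → indicator (d ×-dec e) ≡ 0
indicator-×-no (yes p) e ¬p = ⊥-elim (¬p p)
indicator-×-no (no _)  e _  = refl

length-filter-tabulate : ∀ {a} {A : Set a} {n} {P : Pred A 0ℓ} (P? : Decidable P) (f : Fin n → A) →
  length (filter P? (tabulate f)) ≡ ∑[ i < n ] indicator (P? (f i))
length-filter-tabulate {n = 0}     P? f = refl
length-filter-tabulate {n = suc n} P? f with P? (f Fin.zero)
... | yes _ = cong suc (length-filter-tabulate P? (f ∘ Fin.suc))
... | no _  = length-filter-tabulate P? (f ∘ Fin.suc)

count-as-sum : ∀ {n} {P : Pred (Fin n) 0ℓ} (P? : Decidable P) → count P? ≡ ∑[ x < n ] indicator (P? x)
count-as-sum P? = length-filter-tabulate P? (λ x → x)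

count-init-last : ∀ {m} {P : Pred (Fin (suc m)) 0ℓ} (P? : Decidable P) →
  count P? ≡ ∑[ x < m ] indicator (P? (inject₁ x)) + indicator (P? (top m))
count-init-last P? = trans (count-as-sum P?) (sum-init-last (indicator ∘ P?))

inject₁-CT : ∀ {m} (σ : S (suc m)) {x : Fin m} → inject₁ x ≢ σ ⟨$⟩ˡ top m →
  inject₁ (CT σ x) ≡ σ ⟨$⟩ʳ inject₁ x
inject₁-CT {m} σ {x} x≢σ⁻¹top with σ ⟨$⟩ʳ inject₁ x ≟ top m
... | no _         = inject₁-lower₁ _ _
... | yes σx≡top = ⊥-elim (x≢σ⁻¹top (trans (sym (inverseˡ σ)) (cong (σ ⟨$⟩ˡ_) σx≡top)))

m+p≡n+o⇒m-n≡o-p : ∀ m n o p → m + p ≡ n + o → + m - + n ≡ + o - + p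
m+p≡n+o⇒m-n≡o-p m n o p eq = begin
  + m - + n          ≡⟨ [+m]-[+n]≡m⊖n m n ⟩
  m ⊖ n              ≡⟨ +-cancelˡ-⊖ p m n ⟨
  (p + m) ⊖ (p + n)  ≡⟨ cong₂ _⊖_ (trans (ℕ.+-comm p m) eq) (ℕ.+-comm p n) ⟩
  (n + o) ⊖ (n + p)  ≡⟨ +-cancelˡ-⊖ n o p ⟩
  o ⊖ p              ≡⟨ [+m]-[+n]≡m⊖n o p ⟨
  + o - + p          ∎

module _ {m} (σ τ : S (suc m)) where

  differ? : (x : Fin (suc m)) → Dec (σ ⟨$⟩ʳ x ≢ τ ⟨$⟩ʳ x)
  differ? x = ¬? (σ ⟨$⟩ʳ x ≟ τ ⟨$⟩ʳ x)

  differCT? : (x : Fin m) → Dec (CT σ x ≢ CT τ x)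
  differCT? x = ¬? (CT σ x ≟ CT τ x)

  preimage? : (x : Fin (suc m)) → Dec (x ≡ σ ⟨$⟩ˡ top m ⊎ x ≡ τ ⟨$⟩ˡ top m)
  preimage? x = (x ≟ σ ⟨$⟩ˡ top m) ⊎-dec (x ≟ τ ⟨$⟩ˡ top m)

  δ-support? : (x : Fin (suc m)) → Dec (x ≡ top m ⊎ (x ≡ σ ⟨$⟩ˡ top m ⊎ x ≡ τ ⟨$⟩ˡ top m))
  δ-support? x = (x ≟ top m) ⊎-dec preimage? x

  δ-member? : (x : Fin (suc m)) →
    Dec ((x ≡ top m ⊎ (x ≡ σ ⟨$⟩ˡ top m ⊎ x ≡ τ ⟨$⟩ˡ top m)) × σ ⟨$⟩ʳ x ≢ τ ⟨$⟩ʳ x)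
  δ-member? x = δ-support? x ×-dec differ? x

  δCT-member? : (x : Fin m) →
    Dec ((inject₁ x ≡ σ ⟨$⟩ˡ top m ⊎ inject₁ x ≡ τ ⟨$⟩ˡ top m) × CT σ x ≢ CT τ x)
  δCT-member? x = preimage? (inject₁ x) ×-dec differCT? x

  mismatch : Fin (suc m) → ℕ
  mismatch = indicator ∘ differ?

  mismatchCT : Fin m → ℕ
  mismatchCT = indicator ∘ differCT?

  δ-summand : Fin (suc m) → ℕ
  δ-summand = indicator ∘ δ-member?

  δCT-summand : Fin m → ℕ
  δCT-summand = indicator ∘ δCT-member?

  mismatch-top : mismatch (top m) ≡ δ-summand (top m)
  mismatch-top = sym (indicator-×-yes (δ-support? (top m)) (differ? (top m)) (inj₁ refl))

  mismatch-balance : ∀ x → mismatch (inject₁ x) + δCT-summand x ≡ mismatchCT x + δ-summand (inject₁ x)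
  mismatch-balance x = by-cases (preimage? (inject₁ x))
    where
    by-cases : Dec (inject₁ x ≡ σ ⟨$⟩ˡ top m ⊎ inject₁ x ≡ τ ⟨$⟩ˡ top m) →
      mismatch (inject₁ x) + δCT-summand x ≡ mismatchCT x + δ-summand (inject₁ x)
    by-cases (yes preimage) = begin
      mismatch (inject₁ x) + δCT-summand x   ≡⟨ cong (_+_ (mismatch (inject₁ x))) δCT-summand≡mismatchCT ⟩
      mismatch (inject₁ x) + mismatchCT x    ≡⟨ ℕ.+-comm (mismatch (inject₁ x)) (mismatchCT x) ⟩
      mismatchCT x + mismatch (inject₁ x)    ≡⟨ cong (_+_ (mismatchCT x)) δ-summand≡mismatch ⟨
      mismatchCT x + δ-summand (inject₁ x)   ∎
      where
      δCT-summand≡mismatchCT : δCT-summand x ≡ mismatchCT x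
      δCT-summand≡mismatchCT = indicator-×-yes (preimage? (inject₁ x)) (differCT? x) preimage
      δ-summand≡mismatch : δ-summand (inject₁ x) ≡ mismatch (inject₁ x)
      δ-summand≡mismatch = indicator-×-yes (δ-support? (inject₁ x)) (differ? (inject₁ x)) (inj₂ preimage)
    by-cases (no ¬preimage) = begin
      mismatch (inject₁ x) + δCT-summand x   ≡⟨ cong (_+_ (mismatch (inject₁ x))) δCT-summand≡0 ⟩
      mismatch (inject₁ x) + 0               ≡⟨ cong (_+ 0) mismatch≡mismatchCT ⟩
      mismatchCT x + 0                       ≡⟨ cong (_+_ (mismatchCT x)) δ-summand≡0 ⟨
      mismatchCT x + δ-summand (inject₁ x)   ∎
      where
      δCT-summand≡0 : δCT-summand x ≡ 0
      δCT-summand≡0 = indicator-×-no (preimage? (inject₁ x)) (differCT? x) ¬preimage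
      δ-summand≡0 : δ-summand (inject₁ x) ≡ 0
      δ-summand≡0 = indicator-×-no (δ-support? (inject₁ x)) (differ? (inject₁ x))
        [ fromℕ≢inject₁ ∘ sym , ¬preimage ]
      σ-agrees : inject₁ (CT σ x) ≡ σ ⟨$⟩ʳ inject₁ x
      σ-agrees = inject₁-CT σ (¬preimage ∘ inj₁)
      τ-agrees : inject₁ (CT τ x) ≡ τ ⟨$⟩ʳ inject₁ x
      τ-agrees = inject₁-CT τ (¬preimage ∘ inj₂)
      mismatch≡mismatchCT : mismatch (inject₁ x) ≡ mismatchCT x
      mismatch≡mismatchCT = indicator-cong (differ? (inject₁ x)) (differCT? x)
        (λ σx≢τx CTσx≡CTτx → σx≢τx (trans (sym σ-agrees) (trans (cong inject₁ CTσx≡CTτx) τ-agrees)))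
        (λ CTσx≢CTτx σx≡τx → CTσx≢CTτx (inject₁-injective (trans σ-agrees (trans σx≡τx (sym τ-agrees)))))

  hd+δCT≡hdCT+δ : hd (σ ⟨$⟩ʳ_) (τ ⟨$⟩ʳ_) + δCT σ τ ≡ hd (CT σ) (CT τ) + δ σ τ
  hd+δCT≡hdCT+δ = begin
    hd (σ ⟨$⟩ʳ_) (τ ⟨$⟩ʳ_) + δCT σ τ
      ≡⟨ cong₂ _+_ (count-init-last differ?) (count-as-sum δCT-member?) ⟩
    (∑[ x < m ] mismatch (inject₁ x) + mismatch (top m)) + sum δCT-summand
      ≡⟨ xy∙z≈xz∙y (∑[ x < m ] mismatch (inject₁ x)) (mismatch (top m)) (sum δCT-summand) ⟩
    (∑[ x < m ] mismatch (inject₁ x) + sum δCT-summand) + mismatch (top m)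
      ≡⟨ cong₂ _+_ interior mismatch-top ⟩
    (sum mismatchCT + ∑[ x < m ] δ-summand (inject₁ x)) + δ-summand (top m)
      ≡⟨ ℕ.+-assoc (sum mismatchCT) _ _ ⟩
    sum mismatchCT + (∑[ x < m ] δ-summand (inject₁ x) + δ-summand (top m))
      ≡⟨ cong₂ _+_ (count-as-sum differCT?) (count-init-last δ-member?) ⟨
    hd (CT σ) (CT τ) + δ σ τ
      ∎
    where
    interior : ∑[ x < m ] mismatch (inject₁ x) + sum δCT-summand
             ≡ sum mismatchCT + ∑[ x < m ] δ-summand (inject₁ x)
    interior = begin
      ∑[ x < m ] mismatch (inject₁ x) + sum δCT-summand   ≡⟨ ∑-distrib-+ (mismatch ∘ inject₁) δCT-summand ⟨
      ∑[ x < m ] (mismatch (inject₁ x) + δCT-summand x)   ≡⟨ sum-cong-≗ mismatch-balance ⟩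
      ∑[ x < m ] (mismatchCT x + δ-summand (inject₁ x))   ≡⟨ ∑-distrib-+ mismatchCT (δ-summand ∘ inject₁) ⟩
      sum mismatchCT + ∑[ x < m ] δ-summand (inject₁ x)   ∎

lemma4p1 : ∀ (m : ℕ) (σ τ : S (suc m)) →
    (+ hd (σ ⟨$⟩ʳ_) (τ ⟨$⟩ʳ_)) - (+ hd (CT σ) (CT τ)) ≡ (+ δ σ τ) - (+ δCT σ τ)
lemma4p1 m σ τ =
  m+p≡n+o⇒m-n≡o-p (hd (σ ⟨$⟩ʳ_) (τ ⟨$⟩ʳ_)) (hd (CT σ) (CT τ)) (δ σ τ) (δCT σ τ) (hd+δCT≡hdCT+δ σ τ)
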